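{- Let $q$ be a power of a prime $p$, let $n\geq 2$ be an integer, and write $n=mp^e$ with $e\geq 0$ and $p\nmid m$. Then \[ q^{n-m}\prod_{d\mid m}\bigl(q^{\tau(d)}-1\bigr)^{\phi(d)/\tau(d)} \;\leq\;\frac{q-1}{q}\sum_{d\mid m}\mu(d)\,q^{n/d}, \] where the product and sum run over the positive divisors $d$ of $m$, $\tau(d)$ is the multiplicative order of $q$ modulo $d$ (with $\tau(1)=1$), $\phi$ is Euler's totient function, and $\mu$ is the Möbius function. Moreover, equality holds if and only if either $n=p^e$ (i.e. $m=1$), or $n$ is a prime different from $p$ and $q$ is a primitive root modulo $n$.
   Context: The left-hand side equals the number of normal elements of $\mathbb{F}_{q^n}$ over $\mathbb{F}_q$ (elements $\alpha$ such that $\alpha,\alpha^q,\dots,\alpha^{q^{n-1}}$ are linearly independent over $\mathbb{F}_q$), and the right-hand side equals $n$ times the number of monic irreducible polynomials of degree $n$ over $\mathbb{F}_q$ whose coefficient of $x^{n-1}$ is nonzero; the statement itself is the purely numerical inequality above. -}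

module Defs where

open import Data.Nat as ℕ using (ℕ; zero; suc; _+_; _*_; _∸_; _^_; _≤_)
open import Data.Nat.DivMod using (_/_)
open import Data.Nat.Divisibility using (_∣_; _∣?_)
open import Data.Nat.Coprimality using (Coprime; coprime?)
open import Data.Nat.Primality using (Prime; prime?)
open import Data.Integer as ℤ using (ℤ; +_)
open import Data.List using (List; []; _∷_; map; filter; upTo; length; foldr)
open import Data.Nat.ListAction using (product)
open import Data.List.Relation.Unary.All using (All)
open import Data.Product using (_×_)
open import Relation.Nullary using (¬_; yes; no)
open import Relation.Nullary.Decidable using (_×-dec_)
open import Relation.Binary.PropositionalEquality using (_≡_)

range1 : ℕ → List ℕ
range1 n = map suc (upTo n)

divisors : ℕ → List ℕ
divisors m = filter (_∣? m) (range1 m)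

-- natural-number division, made total (only used for exact divisions)
divℕ : ℕ → ℕ → ℕ
divℕ a zero    = 0
divℕ a (suc b) = a / suc b

-- multiplicative order τ(d) of q modulo d: least k ≥ 1 with q ^ k ≡ 1 (mod d),
-- i.e. d ∣ q ^ k ∸ 1 (q ≥ 1 here).  When gcd(q,d) = 1 this k exists and is ≤ d,
-- so a search over 1..d finds it; the fallback value 1 is never used in the
-- theorem (there d ∣ m and gcd(q,m) = 1).
firstOrd : ℕ → ℕ → List ℕ → ℕ
firstOrd q d []       = 1
firstOrd q d (k ∷ ks) with d ∣? (q ^ k ∸ 1)
... | yes _ = k
... | no  _ = firstOrd q d ks

ord : ℕ → ℕ → ℕ
ord q d = firstOrd q d (range1 d)

totient : ℕ → ℕ
totient d = length (filter (λ k → coprime? k d) (range1 d))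

ω : ℕ → ℕ
ω d = length (filter (λ p → prime? p ×-dec p ∣? d) (range1 d))

-- d is squarefree: no k ≥ 2 (with k ≤ d, which suffices for d ≥ 1) has k² ∣ d
SquareFree : ℕ → Set
SquareFree d = All (λ k → ¬ (k * k ∣ d)) (map (λ j → 2 + j) (upTo (d ∸ 1)))

squareFree? : ∀ d → Relation.Nullary.Dec (SquareFree d)
squareFree? d = Data.List.Relation.Unary.All.all? (λ k → Relation.Nullary.¬? (k * k ∣? d)) _
  where import Data.List.Relation.Unary.All
        import Relation.Nullary

μ : ℕ → ℤ
μ d with squareFree? d
... | yes _ = (ℤ.- ℤ.1ℤ) ℤ.^ ω d
... | no  _ = ℤ.0ℤ

sumℤ : List ℤ → ℤ
sumℤ = foldr ℤ._+_ ℤ.0ℤ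

IsPrimitiveRoot : ℕ → ℕ → Set
IsPrimitiveRoot q n = Coprime q n × ord q n ≡ totient n

lhs : ℕ → ℕ → ℕ → ℕ
lhs q n m = q ^ (n ∸ m) *
  product (map (λ d → (q ^ ord q d ∸ 1) ^ divℕ (totient d) (ord q d)) (divisors m))

mobSum : ℕ → ℕ → ℕ → ℤ
mobSum q n m = sumℤ (map (λ d → μ d ℤ.* (+ (q ^ divℕ n d))) (divisors m))

{-# OPTIONS --safe #-}
-- Let m ≥ 2 and let r be its least prime factor, so φ(r) = r − 1.  Each factor
-- (q^τ(d) − 1)^(φ(d)/τ(d)) is at most q^φ(d), the factor for d = r is at most q^(r−1) − 1,
-- and ∑_{d ∣ m} φ(d) ≤ m; hence
--   q · lhs ≤ (q − 1) q^(n−r+1) (q^(r−1) − 1) = (q − 1)(q^n − q^(n−r+1)).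
-- Since μ ≥ −1, the Möbius sum is at least q^n − ∑_{1 < d ∣ m} q^(n/d), and as the exponents
-- n/d strictly decrease, the subtracted sum is at most q^(n−r+1).  Equality throughout forces
-- τ(r) = r − 1, m = r and e = 0: n is a prime and q a primitive root modulo n.  For m = 1 both
-- sides equal (q − 1) q^n.
module Submission where

open import Defs
open import Data.Nat using (ℕ; _*_; _∸_; _^_; _≤_)
open import Data.Nat.Divisibility using (_∣_)
open import Data.Nat.Primality using (Prime)
open import Data.Integer as ℤ using (+_)
open import Data.Product using (_×_)
open import Data.Sum using (_⊎_)
open import Function.Bundles using (_⇔_)
open import Relation.Nullary using (¬_)
open import Relation.Binary.PropositionalEquality using (_≡_; _≢_)

import Data.Integer.Properties as ℤP
open import Data.Empty using (⊥-elim)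
open import Data.List using (List; []; _∷_; _++_; _∷ʳ_; map; filter; length; iterate; applyUpTo)
open import Data.List.Membership.Propositional using (_∈_)
open import Data.List.Membership.Propositional.Properties using (∈-filter⁺)
open import Data.List.Properties
  using (map-upTo; map-cong-local; map-++; length-map; length-++; length-iterate;
         filter-++; filter-accept; filter-reject; filter-none; filter-all)
open import Data.List.Relation.Unary.All as All using (All; []; _∷_)
open import Data.List.Relation.Unary.All.Properties using (all-filter; map⁺)
open import Data.List.Relation.Unary.Any using (here; there)
open import Data.Nat
open import Data.Nat.Coprimality using (Coprime; coprime?; gcd≡1⇒coprime; coprime⇒gcd≡1; prime⇒coprime)
import Data.Nat.Coprimality as Coprime
open import Data.Nat.Divisibility using (divides; _∣?_; ∣-trans; ∣⇒≤; ∣-refl; 1∣_; ∣1⇒≡1; m∣m*n)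
open import Data.Nat.Divisibility.Core using (hasNonTrivialDivisor)
open import Data.Nat.DivMod using (_/_; n/1≡n; n/n≡1; m/n*n≤m; m*n/n≡m; /-monoʳ-≤)
open import Data.Nat.GCD using (gcd; gcd[m,n]∣m; gcd[m,n]≢0; c*gcd[m,n]≡gcd[cm,cn])
open import Data.Nat.ListAction using (sum; product)
open import Data.Nat.Primality
  using (_Rough_; prime?; prime⇒nonTrivial; prime⇒irreducible; rough∧∣⇒prime; euclidsLemma;
         ¬prime[0]; ¬prime[1])
open import Data.Nat.Properties
open import Algebra.Properties.CommutativeSemigroup +-commutativeSemigroup using (x∙yz≈y∙xz)
open import Data.Nat.Tactic.RingSolver using (solve-∀)
open import Data.Product using (_,_; proj₁; proj₂)
import Data.Product as Product
open import Data.Sum using (inj₁; inj₂)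
import Data.Sum as Sum
open import Data.Unit using (⊤; tt)
open import Function using (_∘_)
open import Function.Bundles using (mk⇔)
open import Level using (0ℓ)
open import Relation.Binary.PropositionalEquality
  using (refl; sym; trans; cong; cong₂; subst; module ≡-Reasoning)
open import Relation.Nullary using (yes; no)
open import Relation.Nullary.Decidable using (_×-dec_)
open import Relation.Unary using (Pred; Decidable)

-- Intervals and ascending lists

applyUpTo≡iterate : ∀ (f : ℕ → ℕ) a k → (∀ i → f i ≡ a + i) → applyUpTo f k ≡ iterate suc a k
applyUpTo≡iterate f a zero    f≡a+ = refl
applyUpTo≡iterate f a (suc k) f≡a+ = cong₂ _∷_ (trans (f≡a+ 0) (+-identityʳ a))
  (applyUpTo≡iterate (f ∘ suc) (suc a) k (λ i → trans (f≡a+ (suc i)) (+-suc a i)))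

range1≡iterate : ∀ m → range1 m ≡ iterate suc 1 m
range1≡iterate m = trans (map-upTo suc m) (applyUpTo≡iterate suc 1 m (λ _ → refl))

iterate-suc-++ : ∀ a k l → iterate suc a (k + l) ≡ iterate suc a k ++ iterate suc (a + k) l
iterate-suc-++ a zero    l = cong (λ b → iterate suc b l) (sym (+-identityʳ a))
iterate-suc-++ a (suc k) l = cong (a ∷_) (trans (iterate-suc-++ (suc a) k l)
  (cong (λ b → iterate suc (suc a) k ++ iterate suc b l) (sym (+-suc a k))))

iterate-suc-∷ʳ : ∀ a k → iterate suc a (suc k) ≡ iterate suc a k ∷ʳ (a + k)
iterate-suc-∷ʳ a k = trans (cong (iterate suc a) (+-comm 1 k)) (iterate-suc-++ a k 1)

iterate-suc-bounds : ∀ a k → All (λ x → a ≤ x × x < a + k) (iterate suc a k)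
iterate-suc-bounds a zero    = []
iterate-suc-bounds a (suc k) = (≤-refl , a<a+[1+k])
  ∷ All.map (λ {x} (a<x , x<) → <⇒≤ a<x , subst (x <_) (sym (+-suc a k)) x<)
            (iterate-suc-bounds (suc a) k)
  where
    a<a+[1+k] : a < a + suc k
    a<a+[1+k] = subst (a <_) (sym (+-suc a k)) (m≤m+n (suc a) k)

∈-iterate-suc : ∀ {a x} k → a ≤ x → x < a + k → x ∈ iterate suc a k
∈-iterate-suc {a} {x} zero    a≤x x<a+0 =
  ⊥-elim (<-irrefl refl (≤-trans x<a+0 (subst (_≤ x) (sym (+-identityʳ a)) a≤x)))
∈-iterate-suc {a} {x} (suc k) a≤x x<    with m≤n⇒m<n∨m≡n a≤x
... | inj₂ refl = here refl
... | inj₁ a<x  = there (∈-iterate-suc k a<x (subst (x <_) (+-suc a k) x<))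

Ascending : ℕ → List ℕ → Set
Ascending b []       = ⊤
Ascending b (x ∷ xs) = b ≤ x × Ascending (suc x) xs

Ascending-weaken : ∀ {b c} xs → b ≤ c → Ascending c xs → Ascending b xs
Ascending-weaken []       b≤c _           = tt
Ascending-weaken (x ∷ xs) b≤c (c≤x , asc) = ≤-trans b≤c c≤x , asc

Ascending-iterate-suc : ∀ a k → Ascending a (iterate suc a k)
Ascending-iterate-suc a zero    = tt
Ascending-iterate-suc a (suc k) = ≤-refl , Ascending-iterate-suc (suc a) k

Ascending⇒All≥ : ∀ {b} xs → Ascending b xs → All (b ≤_) xs
Ascending⇒All≥ []       _           = []
Ascending⇒All≥ (x ∷ xs) (b≤x , asc) =
  b≤x ∷ All.map (≤-trans (≤-trans b≤x (n≤1+n x))) (Ascending⇒All≥ xs asc)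

Ascending-head≤ : ∀ {b x y} xs → Ascending b (x ∷ xs) → y ∈ x ∷ xs → x ≤ y
Ascending-head≤ xs _         (here refl)  = ≤-refl
Ascending-head≤ xs (_ , asc) (there y∈xs) = <⇒≤ (All.lookup (Ascending⇒All≥ xs asc) y∈xs)

module _ {P : Pred ℕ 0ℓ} (P? : Decidable P) where

  Ascending-filter : ∀ {b} xs → Ascending b xs → Ascending b (filter P? xs)
  Ascending-filter []       _ = tt
  Ascending-filter (x ∷ xs) (b≤x , asc) with P? x
  ... | yes _ = b≤x , Ascending-filter xs asc
  ... | no  _ = Ascending-filter xs (Ascending-weaken xs (≤-trans b≤x (n≤1+n x)) asc)

  filter-iterate-suc-∷ʳ : ∀ a k →
    filter P? (iterate suc a (suc k)) ≡ filter P? (iterate suc a k) ++ filter P? (a + k ∷ [])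
  filter-iterate-suc-∷ʳ a k =
    trans (cong (filter P?) (iterate-suc-∷ʳ a k)) (filter-++ P? (iterate suc a k) _)

  length-filter-unique≤1 : ∀ {b} xs → Ascending b xs → (∀ {x y} → P x → P y → x ≡ y) →
                           length (filter P? xs) ≤ 1
  length-filter-unique≤1 xs asc unique =
    length≤1 (filter P? xs) (Ascending-filter xs asc) (all-filter P? xs)
    where
      length≤1 : ∀ {b} ys → Ascending b ys → All P ys → length ys ≤ 1
      length≤1 []           _             _             = z≤n
      length≤1 (y ∷ [])     _             _             = ≤-refl
      length≤1 (y ∷ z ∷ _) (_ , y<z , _) (py ∷ pz ∷ _) = ⊥-elim (<-irrefl (unique py pz) y<z)

-- Gauss' bound  ∑_{d ∣ m} φ(d) ≤ m

1+[1+c′]j+c′≡[1+j][1+c′] : ∀ c′ j → 1 + suc c′ * j + c′ ≡ suc j * suc c′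
1+[1+c′]j+c′≡[1+j][1+c′] = solve-∀

module _ {P Q : Pred ℕ 0ℓ} (P? : Decidable P) (Q? : Decidable Q) (c′ : ℕ)
         (P⇒∣ : ∀ {x} → P x → suc c′ ∣ x)
         (P⇒Q : ∀ {k} → P (k * suc c′) → Q k) (Q⇒P : ∀ {k} → Q k → P (k * suc c′)) where

  private
    c = suc c′

  ¬P-between-multiples : ∀ j {x} → c * j < x → x < suc j * c → ¬ P x
  ¬P-between-multiples j c*j<x x<c*[1+j] px with P⇒∣ px
  ... | divides t refl with t ≤? j
  ... | yes t≤j = <-irrefl refl (≤-trans c*j<x (≤-trans (*-monoˡ-≤ c t≤j) (≤-reflexive (*-comm j c))))
  ... | no  t≰j = <-irrefl refl (≤-trans x<c*[1+j] (*-monoˡ-≤ c (≰⇒> t≰j)))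

  filter-block : ∀ j → filter P? (iterate suc (1 + c * j) c) ≡ map (_* c) (filter Q? (suc j ∷ []))
  filter-block j = begin
      filter P? (iterate suc (1 + c * j) c)
    ≡⟨ cong (filter P?) (iterate-suc-∷ʳ (1 + c * j) c′) ⟩
      filter P? (iterate suc (1 + c * j) c′ ∷ʳ (1 + c * j + c′))
    ≡⟨ filter-++ P? (iterate suc (1 + c * j) c′) _ ⟩
      filter P? (iterate suc (1 + c * j) c′) ++ filter P? (1 + c * j + c′ ∷ [])
    ≡⟨ cong₂ _++_ interior-rejected
                  (cong (λ x → filter P? (x ∷ [])) (1+[1+c′]j+c′≡[1+j][1+c′] c′ j)) ⟩
      filter P? (suc j * c ∷ [])
    ≡⟨ endpoint ⟩
      map (_* c) (filter Q? (suc j ∷ []))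
    ∎
    where
      open ≡-Reasoning
      interior-rejected : filter P? (iterate suc (1 + c * j) c′) ≡ []
      interior-rejected = filter-none P? (All.map
        (λ {x} (lo , hi) → ¬P-between-multiples j lo
                              (subst (x <_) (1+[1+c′]j+c′≡[1+j][1+c′] c′ j) hi))
        (iterate-suc-bounds (1 + c * j) c′))
      endpoint : filter P? (suc j * c ∷ []) ≡ map (_* c) (filter Q? (suc j ∷ []))
      endpoint with Q? (suc j)
      ... | yes q = filter-accept P? (Q⇒P q)
      ... | no ¬q = filter-reject P? (¬q ∘ P⇒Q)

  filter-multiples : ∀ j → filter P? (iterate suc 1 (c * j)) ≡ map (_* c) (filter Q? (iterate suc 1 j))
  filter-multiples zero rewrite *-zeroʳ c = refl
  filter-multiples (suc j) = begin
      filter P? (iterate suc 1 (c * suc j))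
    ≡⟨ cong (filter P? ∘ iterate suc 1) (trans (*-suc c j) (+-comm c (c * j))) ⟩
      filter P? (iterate suc 1 (c * j + c))
    ≡⟨ cong (filter P?) (iterate-suc-++ 1 (c * j) c) ⟩
      filter P? (iterate suc 1 (c * j) ++ iterate suc (1 + c * j) c)
    ≡⟨ filter-++ P? (iterate suc 1 (c * j)) _ ⟩
      filter P? (iterate suc 1 (c * j)) ++ filter P? (iterate suc (1 + c * j) c)
    ≡⟨ cong₂ _++_ (filter-multiples j) (filter-block j) ⟩
      map (_* c) (filter Q? (iterate suc 1 j)) ++ map (_* c) (filter Q? (suc j ∷ []))
    ≡⟨ sym (map-++ (_* c) (filter Q? (iterate suc 1 j)) _) ⟩
      map (_* c) (filter Q? (iterate suc 1 j) ++ filter Q? (suc j ∷ []))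
    ≡⟨ cong (map (_* c)) (sym (filter-++ Q? (iterate suc 1 j) _)) ⟩
      map (_* c) (filter Q? (iterate suc 1 j ∷ʳ suc j))
    ≡⟨ cong (map (_* c) ∘ filter Q?) (sym (iterate-suc-∷ʳ 1 j)) ⟩
      map (_* c) (filter Q? (iterate suc 1 (suc j)))
    ∎
    where open ≡-Reasoning

Cofactor : ℕ → ℕ → ℕ → Set
Cofactor m d x = gcd x m * d ≡ m

cofactor? : ∀ m d → Decidable (Cofactor m d)
cofactor? m d x = gcd x m * d ≟ m

cofactor-unique : ∀ {m x d d′} → m ≢ 0 → Cofactor m d x → Cofactor m d′ x → d ≡ d′
cofactor-unique {m} {x} {d} {d′} m≢0 eq eq′ =
  *-cancelˡ-≡ d d′ (gcd x m) {{≢-nonZero (gcd[m,n]≢0 x m (inj₂ m≢0))}} (trans eq (sym eq′))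

module _ (c′ d′ : ℕ) where
  private
    c = suc c′
    d = suc d′

  gcd[k*c,c*d]≡c*gcd[k,d] : ∀ k → gcd (k * c) (c * d) ≡ c * gcd k d
  gcd[k*c,c*d]≡c*gcd[k,d] k =
    trans (cong (λ x → gcd x (c * d)) (*-comm k c)) (sym (c*gcd[m,n]≡gcd[cm,cn] c k d))

  cofactor⇒∣ : ∀ {x} → Cofactor (c * d) d x → c ∣ x
  cofactor⇒∣ {x} eq = subst (_∣ x) (*-cancelʳ-≡ (gcd x (c * d)) c d eq) (gcd[m,n]∣m x (c * d))

  cofactor⇒coprime : ∀ {k} → Cofactor (c * d) d (k * c) → Coprime k d
  cofactor⇒coprime {k} eq = gcd≡1⇒coprime (*-cancelˡ-≡ (gcd k d) 1 c (*-cancelʳ-≡ _ _ d (begin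
      c * gcd k d * d          ≡⟨ cong (_* d) (sym (gcd[k*c,c*d]≡c*gcd[k,d] k)) ⟩
      gcd (k * c) (c * d) * d  ≡⟨ eq ⟩
      c * d                    ≡⟨ cong (_* d) (sym (*-identityʳ c)) ⟩
      c * 1 * d                ∎)))
    where open ≡-Reasoning

  coprime⇒cofactor : ∀ {k} → Coprime k d → Cofactor (c * d) d (k * c)
  coprime⇒cofactor {k} cop = cong (_* d) (trans (gcd[k*c,c*d]≡c*gcd[k,d] k)
    (trans (cong (c *_) (coprime⇒gcd≡1 cop)) (*-identityʳ c)))

totient≡#cofactor : ∀ m d → m ≢ 0 → d ∣ m →
                    totient d ≡ length (filter (cofactor? m d) (iterate suc 1 m))
totient≡#cofactor _ d       m≢0 (divides zero    refl) = ⊥-elim (m≢0 refl)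
totient≡#cofactor _ zero    m≢0 (divides (suc c′) refl) = ⊥-elim (m≢0 (*-zeroʳ (suc c′)))
totient≡#cofactor _ (suc d′) _  (divides (suc c′) refl) = begin
    length (filter (λ k → coprime? k d) (range1 d))
  ≡⟨ cong (length ∘ filter (λ k → coprime? k d)) (range1≡iterate d) ⟩
    length (filter (λ k → coprime? k d) (iterate suc 1 d))
  ≡⟨ sym (length-map (_* c) (filter (λ k → coprime? k d) (iterate suc 1 d))) ⟩
    length (map (_* c) (filter (λ k → coprime? k d) (iterate suc 1 d)))
  ≡⟨ cong length (sym (filter-multiples (cofactor? (c * d) d) (λ k → coprime? k d) c′
       (cofactor⇒∣ c′ d′) (cofactor⇒coprime c′ d′) (coprime⇒cofactor c′ d′) d)) ⟩
    length (filter (cofactor? (c * d) d) (iterate suc 1 (c * d)))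
  ∎
  where
    open ≡-Reasoning
    c = suc c′
    d = suc d′

+-shift : ∀ a b c {s} → s ≡ b + c → a + s ≡ b + (a + c)
+-shift a b c refl = x∙yz≈y∙xz a b c

module _ {R : ℕ → ℕ → Set} (R? : ∀ d → Decidable (R d)) where

  #relatedTo : List ℕ → ℕ → ℕ
  #relatedTo ds x = length (filter (λ d → R? d x) ds)

  #related : List ℕ → List ℕ → ℕ
  #related ds xs = sum (map (λ d → length (filter (R? d) xs)) ds)

  #related-∷ : ∀ ds x xs → #related ds (x ∷ xs) ≡ #relatedTo ds x + #related ds xs
  #related-∷ []       x xs = refl
  #related-∷ (d ∷ ds) x xs with R? d x
  ... | yes _ = cong suc (+-shift (length (filter (R? d) xs)) (#relatedTo ds x) (#related ds xs)
                                  (#related-∷ ds x xs))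
  ... | no  _ = +-shift (length (filter (R? d) xs)) (#relatedTo ds x) (#related ds xs) (#related-∷ ds x xs)

  #related-[] : ∀ ds → #related ds [] ≡ 0
  #related-[] []       = refl
  #related-[] (d ∷ ds) = #related-[] ds

  #related≤length : ∀ ds xs → (∀ x → #relatedTo ds x ≤ 1) → #related ds xs ≤ length xs
  #related≤length ds []       _           = ≤-reflexive (#related-[] ds)
  #related≤length ds (x ∷ xs) at-most-one = begin
    #related ds (x ∷ xs)                ≡⟨ #related-∷ ds x xs ⟩
    #relatedTo ds x + #related ds xs    ≤⟨ +-mono-≤ (at-most-one x) (#related≤length ds xs at-most-one) ⟩
    suc (length xs)                     ∎
    where open ≤-Reasoning

divisors≡filter-iterate : ∀ m → divisors m ≡ filter (_∣? m) (iterate suc 1 m)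
divisors≡filter-iterate m = cong (filter (_∣? m)) (range1≡iterate m)

-- Each x ∈ [1, m] has the single cofactor m / gcd(x, m), and exactly φ(d) of them have cofactor d.
sum-totient-divisors≤ : ∀ m → m ≢ 0 → sum (map totient (divisors m)) ≤ m
sum-totient-divisors≤ m m≢0 rewrite divisors≡filter-iterate m = begin
    sum (map totient ds)
  ≡⟨ cong sum (map-cong-local (All.map (totient≡#cofactor m _ m≢0) (all-filter (_∣? m) xs))) ⟩
    #related (cofactor? m) ds xs
  ≤⟨ #related≤length (cofactor? m) ds xs at-most-one-cofactor ⟩
    length xs
  ≡⟨ length-iterate suc 1 m ⟩
    m
  ∎
  where
    open ≤-Reasoning
    xs = iterate suc 1 m
    ds = filter (_∣? m) xs
    at-most-one-cofactor : ∀ x → #relatedTo (cofactor? m) ds x ≤ 1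
    at-most-one-cofactor x = length-filter-unique≤1 (λ d → cofactor? m d x) ds
      (Ascending-filter (_∣? m) xs (Ascending-iterate-suc 1 m)) (cofactor-unique {x = x} m≢0)

-- Least prime factors and primes

prime⇒2≤ : ∀ {p} → Prime p → 2 ≤ p
prime⇒2≤ {p} pp = nonTrivial⇒n>1 p {{prime⇒nonTrivial pp}}

record DivisorsView (m : ℕ) : Set where
  field
    r              : ℕ
    rest           : List ℕ
    divisors≡      : divisors m ≡ 1 ∷ r ∷ rest
    r-prime        : Prime r
    r∣m            : r ∣ m
    rest-ascending : Ascending (suc r) rest
    rest∣m         : All (_∣ m) rest
    rest≡[]⇒m≡r    : rest ≡ [] → m ≡ r

divisorsView : ∀ m → 2 ≤ m → DivisorsView m
divisorsView m@(suc m′) 2≤m with filter (_∣? m) (iterate suc 2 m′) in eq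
... | [] = ⊥-elim (¬∈[] (subst (m ∈_) eq (m∈filter)))
  where
    m∈filter : m ∈ filter (_∣? m) (iterate suc 2 m′)
    m∈filter = ∈-filter⁺ (_∣? m) (∈-iterate-suc m′ 2≤m ≤-refl) ∣-refl
    ¬∈[] : ¬ (m ∈ [])
    ¬∈[] ()
... | r ∷ rest = record
  { r = r ; rest = rest
  ; divisors≡ = trans (divisors≡filter-iterate m)
                      (trans (filter-accept (_∣? m) (1∣ m)) (cong (1 ∷_) eq))
  ; r-prime = rough∧∣⇒prime {{n>1⇒nonTrivial (proj₁ ascending)}} r-rough (All.head all∣m)
  ; r∣m = All.head all∣m
  ; rest-ascending = proj₂ ascending
  ; rest∣m = All.tail all∣m
  ; rest≡[]⇒m≡r = λ rest≡[] → m∈[r] (subst (λ ds → m ∈ r ∷ ds) rest≡[] (member ∣-refl 2≤m))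
  }
  where
    member : ∀ {d} → d ∣ m → 2 ≤ d → d ∈ r ∷ rest
    member {d} d∣m 2≤d =
      subst (d ∈_) eq (∈-filter⁺ (_∣? m) (∈-iterate-suc m′ 2≤d (s≤s (∣⇒≤ d∣m))) d∣m)
    ascending : Ascending 2 (r ∷ rest)
    ascending = subst (Ascending 2) eq
      (Ascending-filter (_∣? m) (iterate suc 2 m′) (Ascending-iterate-suc 2 m′))
    all∣m : All (_∣ m) (r ∷ rest)
    all∣m = subst (All (_∣ m)) eq (all-filter (_∣? m) (iterate suc 2 m′))
    r-rough : r Rough m
    r-rough (hasNonTrivialDivisor {d} d<r d∣m) =
      <-irrefl refl (<-≤-trans d<r (Ascending-head≤ rest ascending (member d∣m (nonTrivial⇒n>1 d))))
    m∈[r] : m ∈ r ∷ [] → m ≡ r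
    m∈[r] (here m≡r) = m≡r

divisors-above≡[] : ∀ {p} ds → p ≢ 0 → Ascending (suc p) ds → All (_∣ p) ds → ds ≡ []
divisors-above≡[] []      _   _             _            = refl
divisors-above≡[] (d ∷ _) p≢0 (p<d , _) (d∣p ∷ _) =
  ⊥-elim (<-irrefl refl (<-≤-trans p<d (∣⇒≤ {{≢-nonZero p≢0}} d∣p)))

divisors-prime : ∀ {p} → Prime p → divisors p ≡ 1 ∷ p ∷ []
divisors-prime {p} pp = trans divisors≡ (cong₂ (λ x ds → 1 ∷ x ∷ ds) r≡p
  (divisors-above≡[] rest p≢0 (subst (λ x → Ascending (suc x) rest) r≡p rest-ascending) rest∣m))
  where
    open DivisorsView (divisorsView p (prime⇒2≤ pp))
    p≢0 : p ≢ 0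
    p≢0 p≡0 = <-irrefl (sym p≡0) (≤-trans (s≤s z≤n) (prime⇒2≤ pp))
    r≡p : r ≡ p
    r≡p with prime⇒irreducible pp r∣m
    ... | inj₁ r≡1 = ⊥-elim (¬prime[1] (subst Prime r≡1 r-prime))
    ... | inj₂ r≡p = r≡p

totient-prime : ∀ {p} → Prime p → totient p ≡ p ∸ 1
totient-prime {suc k} pp = begin
    length (filter coprime-p? (range1 p))
  ≡⟨ cong (length ∘ filter coprime-p?) (range1≡iterate p) ⟩
    length (filter coprime-p? (iterate suc 1 p))
  ≡⟨ cong length (filter-iterate-suc-∷ʳ coprime-p? 1 k) ⟩
    length (filter coprime-p? (iterate suc 1 k) ++ filter coprime-p? (p ∷ []))
  ≡⟨ cong₂ (λ xs ys → length (xs ++ ys))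
       (filter-all coprime-p?
          (All.map (λ (1≤x , x<p) {d} → below-coprime 1≤x x<p {d}) (iterate-suc-bounds 1 k)))
       (filter-reject coprime-p? ¬coprime-p) ⟩
    length (iterate suc 1 k ++ [])
  ≡⟨ trans (length-++ (iterate suc 1 k)) (trans (+-identityʳ _) (length-iterate suc 1 k)) ⟩
    k
  ∎
  where
    open ≡-Reasoning
    p = suc k
    coprime-p? : Decidable (λ x → Coprime x p)
    coprime-p? x = coprime? x p
    below-coprime : ∀ {x} → 1 ≤ x → x < p → Coprime x p
    below-coprime 1≤x x<p = Coprime.sym (prime⇒coprime pp {{>-nonZero 1≤x}} x<p)
    ¬coprime-p : ¬ Coprime p p
    ¬coprime-p cop = <-irrefl (sym (cop (∣-refl , ∣-refl))) (prime⇒2≤ pp)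

ω-prime : ∀ {p} → Prime p → ω p ≡ 1
ω-prime {suc k} pp = begin
    length (filter prime-divisor? (range1 p))
  ≡⟨ cong (length ∘ filter prime-divisor?) (range1≡iterate p) ⟩
    length (filter prime-divisor? (iterate suc 1 p))
  ≡⟨ cong length (filter-iterate-suc-∷ʳ prime-divisor? 1 k) ⟩
    length (filter prime-divisor? (iterate suc 1 k) ++ filter prime-divisor? (p ∷ []))
  ≡⟨ cong₂ (λ xs ys → length (xs ++ ys))
       (filter-none prime-divisor?
          (All.map (λ (_ , x<p) → ¬prime-divisor-below x<p) (iterate-suc-bounds 1 k)))
       (filter-accept prime-divisor? (pp , ∣-refl)) ⟩
    1
  ∎
  where
    open ≡-Reasoning
    p = suc k
    prime-divisor? : Decidable (λ x → Prime x × x ∣ p)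
    prime-divisor? x = prime? x ×-dec x ∣? p
    ¬prime-divisor-below : ∀ {x} → x < p → ¬ (Prime x × x ∣ p)
    ¬prime-divisor-below x<p (px , x∣p) with prime⇒irreducible pp x∣p
    ... | inj₁ refl = ¬prime[1] px
    ... | inj₂ refl = <-irrefl refl x<p

prime⇒¬square∣ : ∀ {p k} → Prime p → 2 ≤ k → ¬ (k * k ∣ p)
prime⇒¬square∣ {p} {k} pp 2≤k k*k∣p with prime⇒irreducible pp (∣-trans (m∣m*n {k} k) k*k∣p)
... | inj₁ refl = <-irrefl refl 2≤k
... | inj₂ refl = <-irrefl refl (<-≤-trans p<p*p (∣⇒≤ {{>-nonZero (≤-trans (s≤s z≤n) 2≤k)}} k*k∣p))
  where
    p<p*p : p < p * p
    p<p*p = subst (_< p * p) (*-identityʳ p) (*-monoʳ-< p {{>-nonZero (≤-trans (s≤s z≤n) 2≤k)}} 2≤k)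

prime⇒squareFree : ∀ {p} → Prime p → SquareFree p
prime⇒squareFree pp = map⁺ (All.universal (λ j → prime⇒¬square∣ pp (s≤s (s≤s z≤n))) _)

μ-prime : ∀ {p} → Prime p → μ p ≡ ℤ.-1ℤ
μ-prime {p} pp with squareFree? p
... | yes _  = cong (ℤ._^_ (ℤ.- ℤ.1ℤ)) (ω-prime pp)
... | no ¬sf = ⊥-elim (¬sf (prime⇒squareFree pp))

prime∣prime-power : ∀ {r p} k → Prime r → Prime p → r ∣ p ^ k → r ≡ p
prime∣prime-power zero    pr pp r∣1 = ⊥-elim (¬prime[1] (subst Prime (∣1⇒≡1 r∣1) pr))
prime∣prime-power (suc k) pr pp r∣p^sk with euclidsLemma _ _ pr r∣p^sk
... | inj₂ r∣p^k = prime∣prime-power k pr pp r∣p^k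
... | inj₁ r∣p with prime⇒irreducible pp r∣p
...   | inj₁ refl = ⊥-elim (¬prime[1] pr)
...   | inj₂ r≡p = r≡p

prime-power-coprime : ∀ {r p} k → Prime r → Prime p → r ≢ p → Coprime (p ^ k) r
prime-power-coprime k pr pp r≢p (d∣p^k , d∣r) with prime⇒irreducible pr d∣r
... | inj₁ d≡1 = d≡1
... | inj₂ refl = ⊥-elim (r≢p (prime∣prime-power k pr pp d∣p^k))

-- The Möbius sum

μ≥-1 : ∀ d → ℤ.-1ℤ ℤ.≤ μ d
μ≥-1 d with squareFree? d
... | no _  = ℤ.-≤+
... | yes _ = sign≥-1 (ω d)
  where
    sign≥-1 : ∀ k → ℤ.-1ℤ ℤ.≤ (ℤ.- ℤ.1ℤ) ℤ.^ k
    sign≥-1 zero          = ℤ.-≤+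
    sign≥-1 (suc zero)    = ℤP.≤-refl
    sign≥-1 (suc (suc k)) = subst (ℤ.-1ℤ ℤ.≤_)
      (trans (sym (ℤP.*-identityˡ _)) (ℤP.*-assoc ℤ.-1ℤ ℤ.-1ℤ ((ℤ.- ℤ.1ℤ) ℤ.^ k))) (sign≥-1 k)

powerSum : ℕ → ℕ → List ℕ → ℕ
powerSum q n ds = sum (map (λ d → q ^ divℕ n d) ds)

mobiusTerms : ℕ → ℕ → List ℕ → ℤ.ℤ
mobiusTerms q n ds = sumℤ (map (λ d → μ d ℤ.* + (q ^ divℕ n d)) ds)

-powerSum≤mobiusTerms : ∀ q n ds → ℤ.- + powerSum q n ds ℤ.≤ mobiusTerms q n ds
-powerSum≤mobiusTerms q n []       = ℤP.≤-refl
-powerSum≤mobiusTerms q n (d ∷ ds) = begin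
    ℤ.- + (q ^ divℕ n d + powerSum q n ds)
  ≡⟨ cong ℤ.-_ (ℤP.pos-+ (q ^ divℕ n d) (powerSum q n ds)) ⟩
    ℤ.- (+ (q ^ divℕ n d) ℤ.+ + powerSum q n ds)
  ≡⟨ ℤP.neg-distrib-+ (+ (q ^ divℕ n d)) (+ powerSum q n ds) ⟩
    ℤ.- + (q ^ divℕ n d) ℤ.+ ℤ.- + powerSum q n ds
  ≡⟨ cong (ℤ._+ ℤ.- + powerSum q n ds) (sym (ℤP.-1*i≡-i (+ (q ^ divℕ n d)))) ⟩
    ℤ.-1ℤ ℤ.* + (q ^ divℕ n d) ℤ.+ ℤ.- + powerSum q n ds
  ≤⟨ ℤP.+-mono-≤ (ℤP.*-monoʳ-≤-nonNeg (+ (q ^ divℕ n d)) (μ≥-1 d)) (-powerSum≤mobiusTerms q n ds) ⟩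
    μ d ℤ.* + (q ^ divℕ n d) ℤ.+ mobiusTerms q n ds
  ∎
  where open ℤP.≤-Reasoning

mobSum-lower : ∀ q n m ds → divisors m ≡ 1 ∷ ds → powerSum q n ds ≤ q ^ n →
               + (q ^ n ∸ powerSum q n ds) ℤ.≤ mobSum q n m
mobSum-lower q n m ds divisors≡ S≤q^n rewrite divisors≡ = begin
    + (q ^ n ∸ powerSum q n ds)
  ≡⟨ sym (ℤP.⊖-≥ S≤q^n) ⟩
    q ^ n ℤ.⊖ powerSum q n ds
  ≡⟨ sym (ℤP.m-n≡m⊖n (q ^ n) (powerSum q n ds)) ⟩
    + (q ^ n) ℤ.+ ℤ.- + powerSum q n ds
  ≤⟨ ℤP.+-mono-≤ (ℤP.≤-reflexive μ[1]-term) (-powerSum≤mobiusTerms q n ds) ⟩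
    ℤ.1ℤ ℤ.* + (q ^ divℕ n 1) ℤ.+ mobiusTerms q n ds
  ∎
  where
    open ℤP.≤-Reasoning
    μ[1]-term : + (q ^ n) ≡ ℤ.1ℤ ℤ.* + (q ^ divℕ n 1)
    μ[1]-term = trans (cong (λ k → + (q ^ k)) (sym (n/1≡n n))) (sym (ℤP.*-identityˡ _))

n/[1+d]<n/d : ∀ n d → n ≢ 0 → d ≢ 0 → d ∣ n → divℕ n (suc d) < divℕ n d
n/[1+d]<n/d _ zero     _   d≢0 _                        = ⊥-elim (d≢0 refl)
n/[1+d]<n/d _ (suc d′) n≢0 _   (divides zero refl)     = ⊥-elim (n≢0 refl)
n/[1+d]<n/d _ (suc d′) _   _   (divides (suc c′) refl) =
  subst (n / suc (suc d′) <_) (sym (m*n/n≡m (suc c′) (suc d′)))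
    (*-cancelʳ-< (suc (suc d′)) (n / suc (suc d′)) (suc c′)
      (≤-<-trans (m/n*n≤m n (suc (suc d′))) (*-monoʳ-< (suc c′) (n<1+n (suc d′)))))
  where n = suc c′ * suc d′

[1+r′][1+t′]≡[1+t′+r′t′]+r′ : ∀ r′ t′ → suc r′ * suc t′ ≡ (suc t′ + r′ * t′) + r′
[1+r′][1+t′]≡[1+t′+r′t′]+r′ = solve-∀

t≤r*t∸[r∸1] : ∀ r t → 1 ≤ r → 1 ≤ t → t ≤ r * t ∸ (r ∸ 1)
t≤r*t∸[r∸1] (suc r′) (suc t′) _ _ = begin
  suc t′                              ≤⟨ m≤m+n (suc t′) (r′ * t′) ⟩
  suc t′ + r′ * t′                    ≡⟨ sym (m+n∸n≡m _ r′) ⟩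
  suc t′ + r′ * t′ + r′ ∸ r′          ≡⟨ cong (_∸ r′) (sym ([1+r′][1+t′]≡[1+t′+r′t′]+r′ r′ t′)) ⟩
  suc r′ * suc t′ ∸ r′                ∎
  where open ≤-Reasoning

t<r*t∸[r∸1] : ∀ r t → 2 ≤ r → 2 ≤ t → t < r * t ∸ (r ∸ 1)
t<r*t∸[r∸1] (suc r′) (suc t′) (s≤s 1≤r′) (s≤s 1≤t′) = begin-strict
  suc t′                              ≡⟨ sym (+-identityʳ (suc t′)) ⟩
  suc t′ + 0                          <⟨ +-monoʳ-< (suc t′) (*-mono-≤ 1≤r′ 1≤t′) ⟩
  suc t′ + r′ * t′                    ≡⟨ sym (m+n∸n≡m _ r′) ⟩
  suc t′ + r′ * t′ + r′ ∸ r′          ≡⟨ cong (_∸ r′) (sym ([1+r′][1+t′]≡[1+t′+r′t′]+r′ r′ t′)) ⟩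
  suc r′ * suc t′ ∸ r′                ∎
  where open ≤-Reasoning

divℕ[r*t,r]≡t : ∀ r t → r ≢ 0 → divℕ (r * t) r ≡ t
divℕ[r*t,r]≡t zero    t r≢0 = ⊥-elim (r≢0 refl)
divℕ[r*t,r]≡t (suc r′) t _  = trans (cong (_/ suc r′) (*-comm (suc r′) t)) (m*n/n≡m t (suc r′))

module _ (q : ℕ) (2≤q : 2 ≤ q) where
  private instance
    q≢0 : NonZero q
    q≢0 = >-nonZero (≤-trans (s≤s z≤n) 2≤q)

  q^a+q^a≤q^[1+a] : ∀ a → q ^ a + q ^ a ≤ q ^ suc a
  q^a+q^a≤q^[1+a] a =
    subst (_≤ q ^ suc a) (cong (_+_ (q ^ a)) (+-identityʳ (q ^ a))) (*-monoˡ-≤ (q ^ a) 2≤q)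

  -- The exponents n/d strictly decrease along ds, so the sum stays below the next power of q ≥ 2.
  powerSum<q^[1+n/b] : ∀ n → n ≢ 0 → ∀ {b} ds → b ≢ 0 → Ascending b ds → All (_∣ n) ds →
                       powerSum q n ds < q ^ suc (divℕ n b)
  powerSum<q^[1+n/b] n n≢0 {b} []       _   _           _           = m^n>0 q (suc (divℕ n b))
  powerSum<q^[1+n/b] n n≢0 {b} (d ∷ ds) b≢0 (b≤d , asc) (d∣n ∷ ∣n) = begin-strict
      q ^ divℕ n d + powerSum q n ds
    <⟨ +-monoʳ-< (q ^ divℕ n d) (<-≤-trans (powerSum<q^[1+n/b] n n≢0 ds (λ ()) asc ∣n)
                                            (^-monoʳ-≤ q (n/[1+d]<n/d n d n≢0 d≢0 d∣n))) ⟩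
      q ^ divℕ n d + q ^ divℕ n d
    ≤⟨ q^a+q^a≤q^[1+a] (divℕ n d) ⟩
      q ^ suc (divℕ n d)
    ≤⟨ ^-monoʳ-≤ q (s≤s (divℕ-antitone b≢0 b≤d)) ⟩
      q ^ suc (divℕ n b)
    ∎
    where
      open ≤-Reasoning
      d≢0 : d ≢ 0
      d≢0 refl = b≢0 (n≤0⇒n≡0 b≤d)
      divℕ-antitone : ∀ {b d} → b ≢ 0 → b ≤ d → divℕ n d ≤ divℕ n b
      divℕ-antitone {zero}  b≢0 _   = ⊥-elim (b≢0 refl)
      divℕ-antitone {suc _} {suc _} _ b≤d = /-monoʳ-≤ n b≤d

  powerSum[r∷ds]≤q^[n∸[r∸1]] : ∀ r t ds → 2 ≤ r → 1 ≤ t → Ascending (suc r) ds → All (_∣ r * t) ds →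
    powerSum q (r * t) (r ∷ ds) ≤ q ^ (r * t ∸ (r ∸ 1))
    × (powerSum q (r * t) (r ∷ ds) < q ^ (r * t ∸ (r ∸ 1)) ⊎ (ds ≡ [] × t ≡ 1))
  powerSum[r∷ds]≤q^[n∸[r∸1]] r t [] 2≤r 1≤t _ _
    rewrite +-identityʳ (q ^ divℕ (r * t) r) | divℕ[r*t,r]≡t r t (m<n⇒n≢0 2≤r) =
    ^-monoʳ-≤ q (t≤r*t∸[r∸1] r t (<⇒≤ 2≤r) 1≤t) , strict-unless-t≡1
    where
      strict-unless-t≡1 : q ^ t < q ^ (r * t ∸ (r ∸ 1)) ⊎ ([] ≡ [] × t ≡ 1)
      strict-unless-t≡1 with m≤n⇒m<n∨m≡n 1≤t
      ... | inj₁ 2≤t = inj₁ (^-monoʳ-< q 2≤q (t<r*t∸[r∸1] r t 2≤r 2≤t))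
      ... | inj₂ 1≡t = inj₂ (refl , sym 1≡t)
  powerSum[r∷ds]≤q^[n∸[r∸1]] r t (d ∷ ds) 2≤r 1≤t (r<d , asc) ∣n = <⇒≤ S<B , inj₁ S<B
    where
      r≢0 : r ≢ 0
      r≢0 = m<n⇒n≢0 2≤r
      n≢0 : r * t ≢ 0
      n≢0 n≡0 = <-irrefl (sym n≡0) (*-mono-≤ (≤-trans (s≤s z≤n) 2≤r) 1≤t)
      2≤t : 2 ≤ t
      2≤t with m≤n⇒m<n∨m≡n 1≤t
      ... | inj₁ 2≤t = 2≤t
      ... | inj₂ refl = ⊥-elim (<-irrefl refl
        (<-≤-trans r<d (subst (d ≤_) (*-identityʳ r) (∣⇒≤ {{≢-nonZero n≢0}} (All.head ∣n)))))
      S<B : powerSum q (r * t) (r ∷ d ∷ ds) < q ^ (r * t ∸ (r ∸ 1))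
      S<B = begin-strict
        powerSum q (r * t) (r ∷ d ∷ ds)   <⟨ powerSum<q^[1+n/b] (r * t) n≢0 (r ∷ d ∷ ds) r≢0
                                               (≤-refl , r<d , asc) (m∣m*n t ∷ ∣n) ⟩
        q ^ suc (divℕ (r * t) r)          ≡⟨ cong (λ k → q ^ suc k) (divℕ[r*t,r]≡t r t r≢0) ⟩
        q ^ suc t                         ≤⟨ ^-monoʳ-≤ q (t<r*t∸[r∸1] r t 2≤r 2≤t) ⟩
        q ^ (r * t ∸ (r ∸ 1))             ∎
        where open ≤-Reasoning

-- The factors (q^τ(d) − 1)^(φ(d)/τ(d))

[1+y][1+z]≡1+y+z+y*z : ∀ y z → (1 + y) * (1 + z) ≡ 1 + y + z + y * z
[1+y][1+z]≡1+y+z+y*z = solve-∀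

1+y^[1+j]≤[1+y]^[1+j] : ∀ y j → 1 + y ^ suc j ≤ (1 + y) ^ suc j
1+y+y^[2+j]≤[1+y]^[2+j] : ∀ y j → 1 + y + y ^ suc (suc j) ≤ (1 + y) ^ suc (suc j)

1+y^[1+j]≤[1+y]^[1+j] y zero    = ≤-reflexive (trans (cong suc (*-identityʳ y)) (sym (*-identityʳ (1 + y))))
1+y^[1+j]≤[1+y]^[1+j] y (suc j) = ≤-trans (s≤s (m≤n+m _ y)) (1+y+y^[2+j]≤[1+y]^[2+j] y j)

1+y+y^[2+j]≤[1+y]^[2+j] y j = begin
  1 + y + y * y ^ suc j                   ≤⟨ +-monoˡ-≤ (y * y ^ suc j) (m≤m+n (1 + y) (y ^ suc j)) ⟩
  1 + y + y ^ suc j + y * y ^ suc j       ≡⟨ sym ([1+y][1+z]≡1+y+z+y*z y (y ^ suc j)) ⟩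
  (1 + y) * (1 + y ^ suc j)               ≤⟨ *-monoʳ-≤ (1 + y) (1+y^[1+j]≤[1+y]^[1+j] y j) ⟩
  (1 + y) * (1 + y) ^ suc j               ∎
  where open ≤-Reasoning

[q^τ∸1]^[a/τ]≤q^a : ∀ q .{{_ : NonZero q}} τ a → (q ^ τ ∸ 1) ^ divℕ a τ ≤ q ^ a
[q^τ∸1]^[a/τ]≤q^a q zero     a = m^n>0 q a
[q^τ∸1]^[a/τ]≤q^a q (suc τ′) a = begin
  (q ^ τ ∸ 1) ^ (a / τ)   ≤⟨ ^-monoˡ-≤ (a / τ) (m∸n≤m (q ^ τ) 1) ⟩
  (q ^ τ) ^ (a / τ)       ≡⟨ ^-*-assoc q τ (a / τ) ⟩
  q ^ (τ * (a / τ))       ≤⟨ ^-monoʳ-≤ q (≤-trans (≤-reflexive (*-comm τ (a / τ))) (m/n*n≤m a τ)) ⟩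
  q ^ a                   ∎
  where
    open ≤-Reasoning
    τ = suc τ′

module _ (q : ℕ) (2≤q : 2 ≤ q) where
  private instance
    q≢0 : NonZero q
    q≢0 = >-nonZero (≤-trans (s≤s z≤n) 2≤q)

  2≤q^[1+a] : ∀ a → 2 ≤ q ^ suc a
  2≤q^[1+a] a = ≤-trans 2≤q (subst (_≤ q ^ suc a) (*-identityʳ q) (*-monoʳ-≤ q (m^n>0 q a)))

  1+[q^a∸1]≡q^a : ∀ a → 1 + (q ^ a ∸ 1) ≡ q ^ a
  1+[q^a∸1]≡q^a a = trans (+-comm 1 _) (m∸n+n≡m (m^n>0 q a))

  1≤q^a∸1 : ∀ a → 1 ≤ a → 1 ≤ q ^ a ∸ 1 × (1 < q ^ a ∸ 1 ⊎ q ^ a ≡ 2)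
  1≤q^a∸1 (suc a) _ with m≤n⇒m<n∨m≡n (∸-monoˡ-≤ 1 (2≤q^[1+a] a))
  ... | inj₁ 1<q^a∸1 = <⇒≤ 1<q^a∸1 , inj₁ 1<q^a∸1
  ... | inj₂ 1≡q^a∸1 =
    ≤-reflexive 1≡q^a∸1 , inj₂ (trans (sym (1+[q^a∸1]≡q^a (suc a))) (cong suc (sym 1≡q^a∸1)))

  [q^τ∸1]^j≤q^a∸1 : ∀ τ j a → 1 ≤ τ → 1 ≤ a → j * τ ≤ a →
    (q ^ τ ∸ 1) ^ j ≤ q ^ a ∸ 1 × ((q ^ τ ∸ 1) ^ j < q ^ a ∸ 1 ⊎ τ ≡ a ⊎ q ^ a ≡ 2)
  [q^τ∸1]^j≤q^a∸1 τ zero a _ 1≤a _ = Product.map₂ (Sum.map₂ inj₂) (1≤q^a∸1 a 1≤a)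
  [q^τ∸1]^j≤q^a∸1 τ (suc zero) a _ _ τ+0≤a with m≤n⇒m<n∨m≡n (subst (_≤ a) (+-identityʳ τ) τ+0≤a)
  ... | inj₁ τ<a = <⇒≤ y<q^a∸1 , inj₁ y<q^a∸1
    where y<q^a∸1 : (q ^ τ ∸ 1) * 1 < q ^ a ∸ 1
          y<q^a∸1 = subst (_< q ^ a ∸ 1) (sym (*-identityʳ _)) (∸-monoˡ-< (^-monoʳ-< q 2≤q τ<a) (m^n>0 q τ))
  ... | inj₂ refl = ≤-reflexive (*-identityʳ _) , inj₂ (inj₁ refl)
  [q^τ∸1]^j≤q^a∸1 τ@(suc τ′) (suc (suc j)) a _ _ jτ≤a = <⇒≤ y^j<q^a∸1 , inj₁ y^j<q^a∸1
    where
      y = q ^ τ ∸ 1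
      1≤y : 1 ≤ y
      1≤y = ∸-monoˡ-≤ 1 (2≤q^[1+a] τ′)
      2+y^j≤q^a : 2 + y ^ suc (suc j) ≤ q ^ a
      2+y^j≤q^a = begin
        2 + y ^ suc (suc j)         ≤⟨ s≤s (+-monoˡ-≤ (y ^ suc (suc j)) 1≤y) ⟩
        1 + y + y ^ suc (suc j)     ≤⟨ 1+y+y^[2+j]≤[1+y]^[2+j] y j ⟩
        (1 + y) ^ suc (suc j)       ≡⟨ cong (_^ suc (suc j)) (1+[q^a∸1]≡q^a τ) ⟩
        (q ^ τ) ^ suc (suc j)       ≡⟨ ^-*-assoc q τ (suc (suc j)) ⟩
        q ^ (τ * suc (suc j))       ≤⟨ ^-monoʳ-≤ q (subst (_≤ a) (*-comm (suc (suc j)) τ) jτ≤a) ⟩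
        q ^ a                       ∎
        where open ≤-Reasoning
      y^j<q^a∸1 : y ^ suc (suc j) < q ^ a ∸ 1
      y^j<q^a∸1 = ∸-monoˡ-≤ 1 2+y^j≤q^a

  [q^τ∸1]^[a/τ]≤q^a∸1 : ∀ τ a → 1 ≤ a →
    (q ^ τ ∸ 1) ^ divℕ a τ ≤ q ^ a ∸ 1 × ((q ^ τ ∸ 1) ^ divℕ a τ < q ^ a ∸ 1 ⊎ τ ≡ a ⊎ q ^ a ≡ 2)
  [q^τ∸1]^[a/τ]≤q^a∸1 zero     a 1≤a = Product.map₂ (Sum.map₂ inj₂) (1≤q^a∸1 a 1≤a)
  [q^τ∸1]^[a/τ]≤q^a∸1 (suc τ′) a 1≤a =
    [q^τ∸1]^j≤q^a∸1 (suc τ′) (a / suc τ′) a (s≤s z≤n) 1≤a (m/n*n≤m a (suc τ′))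

-- The main estimate

[1+x]+y≡x+[1+y] : ∀ x y → 1 + x + y ≡ x + (1 + y)
[1+x]+y≡x+[1+y] = solve-∀

q[e[t[fp]]]≡t[[qe][fp]] : ∀ q e t f p → q * (e * (t * (f * p))) ≡ t * ((q * e) * (f * p))
q[e[t[fp]]]≡t[[qe][fp]] = solve-∀

e[gy]≡[ey]g : ∀ e g y → e * (g * y) ≡ (e * y) * g
e[gy]≡[ey]g = solve-∀

-- X is q · lhs once divisors m = 1 ∷ r ∷ rest, and R is q − 1 times the lower bound for the Möbius sum.
module Estimate (q : ℕ) (2≤q : 2 ≤ q) (n m a Y F P S : ℕ)
  (F≤ : F ≤ q ^ a ∸ 1) (P≤ : P ≤ q ^ Y) (1+a+Y≤m : 1 + a + Y ≤ m) (m≤n : m ≤ n)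
  (S≤ : S ≤ q ^ (n ∸ a)) where

  private instance
    q≢0 : NonZero q
    q≢0 = >-nonZero (≤-trans (s≤s z≤n) 2≤q)
    q∸1≢0 : NonZero (q ∸ 1)
    q∸1≢0 = >-nonZero (∸-monoˡ-≤ 1 2≤q)
    q^1+[n∸m]≢0 : NonZero (q ^ (1 + (n ∸ m)))
    q^1+[n∸m]≢0 = m^n≢0 q (1 + (n ∸ m))
    q^Y≢0 : NonZero (q ^ Y)
    q^Y≢0 = m^n≢0 q Y

  X Middle R : ℕ
  X      = q * (q ^ (n ∸ m) * ((q ∸ 1) * (F * P)))
  Middle = (q ∸ 1) * (q ^ (n ∸ a) * (q ^ a ∸ 1))
  R      = (q ∸ 1) * (q ^ n ∸ S)

  a≤n : a ≤ n
  a≤n = ≤-trans (≤-trans (m≤m+n a (1 + Y)) (≤-reflexive (+-suc a Y))) (≤-trans 1+a+Y≤m m≤n)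

  1+[n∸m]+Y≤n∸a : 1 + (n ∸ m) + Y ≤ n ∸ a
  1+[n∸m]+Y≤n∸a with m≤n⇒∃[o]m+o≡n m≤n
  ... | v , refl = begin
      1 + (m + v ∸ m) + Y   ≡⟨ cong (λ k → 1 + k + Y) (m+n∸m≡n m v) ⟩
      1 + v + Y             ≡⟨ [1+x]+y≡x+[1+y] v Y ⟩
      v + (1 + Y)           ≤⟨ +-monoʳ-≤ v (subst (_≤ m ∸ a) (m+n∸m≡n a (1 + Y)) (∸-monoˡ-≤ a a+[1+Y]≤m)) ⟩
      v + (m ∸ a)           ≡⟨ sym (+-∸-assoc v (≤-trans (m≤m+n a (1 + Y)) a+[1+Y]≤m)) ⟩
      v + m ∸ a             ≡⟨ cong (_∸ a) (+-comm v m) ⟩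
      m + v ∸ a             ∎
    where
      open ≤-Reasoning
      a+[1+Y]≤m : a + (1 + Y) ≤ m
      a+[1+Y]≤m = ≤-trans (≤-reflexive (+-suc a Y)) 1+a+Y≤m

  X≡ : X ≡ (q ∸ 1) * (q ^ (1 + (n ∸ m)) * (F * P))
  X≡ = q[e[t[fp]]]≡t[[qe][fp]] q (q ^ (n ∸ m)) (q ∸ 1) F P

  bound-with-F=q^a∸1 : q ^ (1 + (n ∸ m)) * ((q ^ a ∸ 1) * q ^ Y) ≤ q ^ (n ∸ a) * (q ^ a ∸ 1)
  bound-with-F=q^a∸1 = begin
      q ^ (1 + (n ∸ m)) * ((q ^ a ∸ 1) * q ^ Y)   ≡⟨ e[gy]≡[ey]g (q ^ (1 + (n ∸ m))) (q ^ a ∸ 1) (q ^ Y) ⟩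
      q ^ (1 + (n ∸ m)) * q ^ Y * (q ^ a ∸ 1)     ≡⟨ cong (_* (q ^ a ∸ 1)) (sym (^-distribˡ-+-* q (1 + (n ∸ m)) Y)) ⟩
      q ^ (1 + (n ∸ m) + Y) * (q ^ a ∸ 1)         ≤⟨ *-monoˡ-≤ (q ^ a ∸ 1) (^-monoʳ-≤ q 1+[n∸m]+Y≤n∸a) ⟩
      q ^ (n ∸ a) * (q ^ a ∸ 1)                   ∎
    where open ≤-Reasoning

  X≤Middle : X ≤ Middle
  X≤Middle = subst (_≤ Middle) (sym X≡) (*-monoʳ-≤ (q ∸ 1)
    (≤-trans (*-monoʳ-≤ (q ^ (1 + (n ∸ m))) (*-mono-≤ F≤ P≤)) bound-with-F=q^a∸1))

  X<Middle : F < q ^ a ∸ 1 → X < Middle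
  X<Middle F< = subst (_< Middle) (sym X≡) (*-monoʳ-< (q ∸ 1) (begin-strict
      q ^ (1 + (n ∸ m)) * (F * P)                 ≤⟨ *-monoʳ-≤ (q ^ (1 + (n ∸ m))) (*-monoʳ-≤ F P≤) ⟩
      q ^ (1 + (n ∸ m)) * (F * q ^ Y)             <⟨ *-monoʳ-< (q ^ (1 + (n ∸ m))) (*-monoˡ-< (q ^ Y) F<) ⟩
      q ^ (1 + (n ∸ m)) * ((q ^ a ∸ 1) * q ^ Y)   ≤⟨ bound-with-F=q^a∸1 ⟩
      q ^ (n ∸ a) * (q ^ a ∸ 1)                   ∎))
    where open ≤-Reasoning

  q^[n∸a][q^a∸1]≡q^n∸q^[n∸a] : q ^ (n ∸ a) * (q ^ a ∸ 1) ≡ q ^ n ∸ q ^ (n ∸ a)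
  q^[n∸a][q^a∸1]≡q^n∸q^[n∸a] = begin
      q ^ (n ∸ a) * (q ^ a ∸ 1)               ≡⟨ *-distribˡ-∸ (q ^ (n ∸ a)) (q ^ a) 1 ⟩
      q ^ (n ∸ a) * q ^ a ∸ q ^ (n ∸ a) * 1   ≡⟨ cong₂ _∸_ q^[n∸a]q^a≡q^n (*-identityʳ (q ^ (n ∸ a))) ⟩
      q ^ n ∸ q ^ (n ∸ a)                     ∎
    where
      open ≡-Reasoning
      q^[n∸a]q^a≡q^n : q ^ (n ∸ a) * q ^ a ≡ q ^ n
      q^[n∸a]q^a≡q^n = trans (sym (^-distribˡ-+-* q (n ∸ a) a)) (cong (q ^_) (m∸n+n≡m a≤n))

  Middle≤R : Middle ≤ R
  Middle≤R = *-monoʳ-≤ (q ∸ 1)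
    (subst (_≤ q ^ n ∸ S) (sym q^[n∸a][q^a∸1]≡q^n∸q^[n∸a]) (∸-monoʳ-≤ (q ^ n) S≤))

  Middle<R : S < q ^ (n ∸ a) → Middle < R
  Middle<R S< = *-monoʳ-< (q ∸ 1) (subst (_< q ^ n ∸ S) (sym q^[n∸a][q^a∸1]≡q^n∸q^[n∸a])
    (∸-monoʳ-< S< (^-monoʳ-≤ q (m∸n≤m n a))))

-- Both sides in the cases of equality

orderFactor : ℕ → ℕ → ℕ
orderFactor q d = (q ^ ord q d ∸ 1) ^ divℕ (totient d) (ord q d)

ord[q,1]≡1 : ∀ q → ord q 1 ≡ 1
ord[q,1]≡1 q with 1 ∣? (q ^ 1 ∸ 1)
... | yes _  = refl
... | no ¬1∣ = ⊥-elim (¬1∣ (1∣ _))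

orderFactor[q,1]≡q∸1 : ∀ q → orderFactor q 1 ≡ q ∸ 1
orderFactor[q,1]≡q∸1 q rewrite ord[q,1]≡1 q = trans (*-identityʳ (q * 1 ∸ 1)) (cong (_∸ 1) (*-identityʳ q))

product-orderFactor≤ : ∀ q .{{_ : NonZero q}} ds →
                       product (map (orderFactor q) ds) ≤ q ^ sum (map totient ds)
product-orderFactor≤ q []       = ≤-refl
product-orderFactor≤ q (d ∷ ds) = ≤-trans
  (*-mono-≤ ([q^τ∸1]^[a/τ]≤q^a q (ord q d) (totient d)) (product-orderFactor≤ q ds))
  (≤-reflexive (sym (^-distribˡ-+-* q (totient d) (sum (map totient ds)))))

mobSum[q,n,1]≡q^n : ∀ q n → mobSum q n 1 ≡ + (q ^ n)
mobSum[q,n,1]≡q^n q n =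
  trans (ℤP.+-identityʳ _) (trans (ℤP.*-identityˡ _) (cong (λ k → + (q ^ k)) (n/1≡n n)))

q*lhs[q,n,1]≡[q∸1]q^n : ∀ q n → 1 ≤ n → q * lhs q n 1 ≡ (q ∸ 1) * q ^ n
q*lhs[q,n,1]≡[q∸1]q^n q n 1≤n = begin
    q * (q ^ (n ∸ 1) * (orderFactor q 1 * 1))
  ≡⟨ cong (λ x → q * (q ^ (n ∸ 1) * x)) (trans (*-identityʳ _) (orderFactor[q,1]≡q∸1 q)) ⟩
    q * (q ^ (n ∸ 1) * (q ∸ 1))
  ≡⟨ trans (sym (*-assoc q _ _)) (*-comm (q ^ suc (n ∸ 1)) (q ∸ 1)) ⟩
    (q ∸ 1) * q ^ suc (n ∸ 1)
  ≡⟨ cong (λ k → (q ∸ 1) * q ^ k) (trans (+-comm 1 (n ∸ 1)) (m∸n+n≡m 1≤n)) ⟩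
    (q ∸ 1) * q ^ n
  ∎
  where open ≡-Reasoning

equality-m≡1 : ∀ q n → 1 ≤ n → + (q * lhs q n 1) ≡ + (q ∸ 1) ℤ.* mobSum q n 1
equality-m≡1 q n 1≤n = begin
    + (q * lhs q n 1)           ≡⟨ cong +_ (q*lhs[q,n,1]≡[q∸1]q^n q n 1≤n) ⟩
    + ((q ∸ 1) * q ^ n)         ≡⟨ ℤP.pos-* (q ∸ 1) (q ^ n) ⟩
    + (q ∸ 1) ℤ.* + (q ^ n)     ≡⟨ cong (+ (q ∸ 1) ℤ.*_) (sym (mobSum[q,n,1]≡q^n q n)) ⟩
    + (q ∸ 1) ℤ.* mobSum q n 1  ∎
  where open ≡-Reasoning

divℕ[x,x]≡1 : ∀ x → x ≢ 0 → divℕ x x ≡ 1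
divℕ[x,x]≡1 zero    x≢0 = ⊥-elim (x≢0 refl)
divℕ[x,x]≡1 (suc x) _   = n/n≡1 (suc x)

module _ {q n′ : ℕ} (pn : Prime (suc n′)) where
  private
    n = suc n′
    n′≢0 : n′ ≢ 0
    n′≢0 refl = ¬prime[1] pn

  mobSum-prime : 1 ≤ q → mobSum q n n ≡ + (q ^ n ∸ q)
  mobSum-prime 1≤q = begin
      mobiusTerms q n (divisors n)
    ≡⟨ cong (mobiusTerms q n) (divisors-prime pn) ⟩
      ℤ.1ℤ ℤ.* + (q ^ divℕ n 1) ℤ.+ (μ n ℤ.* + (q ^ divℕ n n) ℤ.+ ℤ.0ℤ)
    ≡⟨ cong₂ (λ x y → x ℤ.+ (y ℤ.+ ℤ.0ℤ)) (trans (ℤP.*-identityˡ _) (cong (λ k → + (q ^ k)) (n/1≡n n)))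
             (trans (cong₂ ℤ._*_ (μ-prime pn) (cong (λ k → + (q ^ k)) (n/n≡1 n))) (ℤP.-1*i≡-i _)) ⟩
      + (q ^ n) ℤ.+ (ℤ.- + (q * 1) ℤ.+ ℤ.0ℤ)
    ≡⟨ cong (λ x → + (q ^ n) ℤ.+ x) (trans (ℤP.+-identityʳ _) (cong (λ x → ℤ.- + x) (*-identityʳ q))) ⟩
      + (q ^ n) ℤ.+ ℤ.- + q
    ≡⟨ ℤP.m-n≡m⊖n (q ^ n) q ⟩
      q ^ n ℤ.⊖ q
    ≡⟨ ℤP.⊖-≥ (subst (_≤ q ^ n) (*-identityʳ q) (*-monoʳ-≤ q (m^n>0 q {{>-nonZero 1≤q}} n′))) ⟩
      + (q ^ n ∸ q)
    ∎
    where open ≡-Reasoning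

  q*lhs-prime : IsPrimitiveRoot q n → q * lhs q n n ≡ (q ∸ 1) * (q ^ n ∸ q)
  q*lhs-prime (_ , ord≡totient) = begin
      q * (q ^ (n ∸ n) * product (map (orderFactor q) (divisors n)))
    ≡⟨ cong (λ ds → q * (q ^ (n ∸ n) * product (map (orderFactor q) ds))) (divisors-prime pn) ⟩
      q * (q ^ (n ∸ n) * (orderFactor q 1 * (orderFactor q n * 1)))
    ≡⟨ cong₂ (λ k x → q * (q ^ k * x)) (n∸n≡0 n)
             (cong₂ _*_ (orderFactor[q,1]≡q∸1 q) (trans (*-identityʳ _) orderFactor[q,n]≡q^n′∸1)) ⟩
      q * (1 * ((q ∸ 1) * (q ^ n′ ∸ 1)))
    ≡⟨ cong (q *_) (*-identityˡ _) ⟩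
      q * ((q ∸ 1) * (q ^ n′ ∸ 1))
    ≡⟨ trans (sym (*-assoc q (q ∸ 1) _))
             (trans (cong (_* (q ^ n′ ∸ 1)) (*-comm q (q ∸ 1))) (*-assoc (q ∸ 1) q _)) ⟩
      (q ∸ 1) * (q * (q ^ n′ ∸ 1))
    ≡⟨ cong ((q ∸ 1) *_) (trans (*-distribˡ-∸ q (q ^ n′) 1) (cong (q ^ n ∸_) (*-identityʳ q))) ⟩
      (q ∸ 1) * (q ^ n ∸ q)
    ∎
    where
      open ≡-Reasoning
      orderFactor[q,n]≡q^n′∸1 : orderFactor q n ≡ q ^ n′ ∸ 1
      orderFactor[q,n]≡q^n′∸1 rewrite ord≡totient | totient-prime pn =
        trans (cong ((q ^ n′ ∸ 1) ^_) (divℕ[x,x]≡1 n′ n′≢0)) (*-identityʳ _)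

  equality-prime′ : 1 ≤ q → IsPrimitiveRoot q n → + (q * lhs q n n) ≡ + (q ∸ 1) ℤ.* mobSum q n n
  equality-prime′ 1≤q prim-root = begin
      + (q * lhs q n n)               ≡⟨ cong +_ (q*lhs-prime prim-root) ⟩
      + ((q ∸ 1) * (q ^ n ∸ q))       ≡⟨ ℤP.pos-* (q ∸ 1) _ ⟩
      + (q ∸ 1) ℤ.* + (q ^ n ∸ q)     ≡⟨ cong (+ (q ∸ 1) ℤ.*_) (sym (mobSum-prime 1≤q)) ⟩
      + (q ∸ 1) ℤ.* mobSum q n n      ∎
    where open ≡-Reasoning

equality-prime : ∀ {q n} → Prime n → 1 ≤ q → IsPrimitiveRoot q n →
                 + (q * lhs q n n) ≡ + (q ∸ 1) ℤ.* mobSum q n n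
equality-prime {n = zero}  p0 = ⊥-elim (¬prime[0] p0)
equality-prime {n = suc _} pn = equality-prime′ pn

-- The case m ≥ 2

q^a≡2⇒a≡1 : ∀ {q} a → 2 ≤ q → q ^ a ≡ 2 → a ≡ 1
q^a≡2⇒a≡1 zero          _   ()
q^a≡2⇒a≡1 (suc zero)    _   _      = refl
q^a≡2⇒a≡1 {q} (suc (suc a)) 2≤q q^a≡2 = ⊥-elim (<-irrefl (sym q^a≡2) (begin-strict
  2              <⟨ s≤s (s≤s (s≤s z≤n)) ⟩
  2 * 2          ≤⟨ *-mono-≤ 2≤q (≤-trans 2≤q (subst (_≤ q ^ suc a) (*-identityʳ q) (*-monoʳ-≤ q 1≤q^a))) ⟩
  q * q ^ suc a  ∎))
  where
    open ≤-Reasoning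
    1≤q^a : 1 ≤ q ^ a
    1≤q^a = m^n>0 q {{>-nonZero (≤-trans (s≤s z≤n) 2≤q)}} a

module Composite {p q k n m e : ℕ} (pp : Prime p) (1≤k : 1 ≤ k) (q≡p^k : q ≡ p ^ k)
                 (n≡m*p^e : n ≡ m * p ^ e) (p∤m : ¬ p ∣ m) (2≤m : 2 ≤ m) where

  open DivisorsView (divisorsView m 2≤m)

  private instance
    p≢0 : NonZero p
    p≢0 = >-nonZero (≤-trans (s≤s z≤n) (prime⇒2≤ pp))

  p≤q : p ≤ q
  p≤q = subst (p ≤_) (sym q≡p^k) (subst (_≤ p ^ k) (*-identityʳ p) (^-monoʳ-≤ p 1≤k))

  2≤q : 2 ≤ q
  2≤q = ≤-trans (prime⇒2≤ pp) p≤q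

  private instance
    q≢0 : NonZero q
    q≢0 = >-nonZero (≤-trans (s≤s z≤n) 2≤q)

  a Y F P S : ℕ
  a = totient r
  Y = sum (map totient rest)
  F = orderFactor q r
  P = product (map (orderFactor q) rest)
  S = powerSum q n (r ∷ rest)

  a≡r∸1 : a ≡ r ∸ 1
  a≡r∸1 = totient-prime r-prime

  1≤a : 1 ≤ a
  1≤a = subst (1 ≤_) (sym a≡r∸1) (∸-monoˡ-≤ 1 (prime⇒2≤ r-prime))

  F-bound : F ≤ q ^ a ∸ 1 × (F < q ^ a ∸ 1 ⊎ ord q r ≡ a ⊎ q ^ a ≡ 2)
  F-bound = [q^τ∸1]^[a/τ]≤q^a∸1 q 2≤q (ord q r) a 1≤a

  1+a+Y≤m : 1 + a + Y ≤ m
  1+a+Y≤m = subst (λ ds → sum (map totient ds) ≤ m) divisors≡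
    (sum-totient-divisors≤ m (m<n⇒n≢0 2≤m))

  m≤n : m ≤ n
  m≤n = subst (m ≤_) (sym n≡m*p^e) (subst (_≤ m * p ^ e) (*-identityʳ m) (*-monoʳ-≤ m (m^n>0 p e)))

  s t : ℕ
  s = _∣_.quotient r∣m
  t = s * p ^ e

  n≡r*t : n ≡ r * t
  n≡r*t = begin
    n                 ≡⟨ n≡m*p^e ⟩
    m * p ^ e         ≡⟨ cong (_* p ^ e) (_∣_.equality r∣m) ⟩
    s * r * p ^ e     ≡⟨ cong (_* p ^ e) (*-comm s r) ⟩
    r * s * p ^ e     ≡⟨ *-assoc r s (p ^ e) ⟩
    r * t             ∎
    where open ≡-Reasoning

  1≤t : 1 ≤ t
  1≤t = *-mono-≤ 1≤s (m^n>0 p e)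
    where
      1≤s : 1 ≤ s
      1≤s = n≢0⇒n>0 (λ s≡0 → m<n⇒n≢0 2≤m (trans (_∣_.equality r∣m) (cong (_* r) s≡0)))

  t≡1⇒e≡0 : t ≡ 1 → e ≡ 0
  t≡1⇒e≡0 t≡1 with m^n≡1⇒n≡0∨m≡1 p e (m*n≡1⇒n≡1 s (p ^ e) t≡1)
  ... | inj₁ e≡0 = e≡0
  ... | inj₂ p≡1 = ⊥-elim (¬prime[1] (subst Prime p≡1 pp))

  rest∣n : All (_∣ n) rest
  rest∣n = All.map (λ d∣m → ∣-trans d∣m (divides (p ^ e) (trans n≡m*p^e (*-comm m (p ^ e))))) rest∣m

  S-bound : S ≤ q ^ (n ∸ a) × (S < q ^ (n ∸ a) ⊎ (rest ≡ [] × e ≡ 0))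
  S-bound rewrite n≡r*t | a≡r∸1 = Product.map₂ (Sum.map₂ (Product.map₂ t≡1⇒e≡0))
    (powerSum[r∷ds]≤q^[n∸[r∸1]] q 2≤q r t rest (prime⇒2≤ r-prime) 1≤t rest-ascending
      (subst (λ x → All (_∣ x) rest) n≡r*t rest∣n))

  S≤q^n : S ≤ q ^ n
  S≤q^n = ≤-trans (proj₁ S-bound) (^-monoʳ-≤ q (m∸n≤m n a))

  open Estimate q 2≤q n m a Y F P S
    (proj₁ F-bound) (product-orderFactor≤ q rest) 1+a+Y≤m m≤n (proj₁ S-bound)

  q*lhs≡X : q * lhs q n m ≡ X
  q*lhs≡X = cong (λ x → q * (q ^ (n ∸ m) * x))
    (trans (cong (product ∘ map (orderFactor q)) divisors≡) (cong (_* (F * P)) (orderFactor[q,1]≡q∸1 q)))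

  R≤rhs : + R ℤ.≤ + (q ∸ 1) ℤ.* mobSum q n m
  R≤rhs = subst (ℤ._≤ + (q ∸ 1) ℤ.* mobSum q n m) (sym (ℤP.pos-* (q ∸ 1) (q ^ n ∸ S)))
    (ℤP.*-monoˡ-≤-nonNeg (+ (q ∸ 1)) (mobSum-lower q n m (r ∷ rest) divisors≡ S≤q^n))

  inequality : + (q * lhs q n m) ℤ.≤ + (q ∸ 1) ℤ.* mobSum q n m
  inequality = ℤP.≤-trans (ℤ.+≤+ (subst (_≤ R) (sym q*lhs≡X) (≤-trans X≤Middle Middle≤R))) R≤rhs

  X<R⇒≢ : X < R → + (q * lhs q n m) ≢ + (q ∸ 1) ℤ.* mobSum q n m
  X<R⇒≢ X<R eq = ℤP.<-irrefl eq (ℤP.<-≤-trans (ℤ.+<+ (subst (_< R) (sym q*lhs≡X) X<R)) R≤rhs)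

  q^a≢2 : q ^ a ≢ 2
  q^a≢2 q^a≡2 = p∤m (subst (_∣ m) (trans r≡2 (sym p≡2)) r∣m)
    where
      a≡1 : a ≡ 1
      a≡1 = q^a≡2⇒a≡1 a 2≤q q^a≡2
      r≡2 : r ≡ 2
      r≡2 = trans (sym (m∸n+n≡m (≤-trans (s≤s z≤n) (prime⇒2≤ r-prime))))
                  (cong (_+ 1) (trans (sym a≡r∸1) a≡1))
      q≡2 : q ≡ 2
      q≡2 = trans (sym (*-identityʳ q)) (trans (cong (q ^_) (sym a≡1)) q^a≡2)
      p≡2 : p ≡ 2
      p≡2 = ≤-antisym (subst (p ≤_) q≡2 p≤q) (prime⇒2≤ pp)

  equality⇒prime-primitive : + (q * lhs q n m) ≡ + (q ∸ 1) ℤ.* mobSum q n m →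
                             Prime n × n ≢ p × IsPrimitiveRoot q n
  equality⇒prime-primitive eq with proj₂ F-bound | proj₂ S-bound
  ... | inj₁ F<                 | _       = ⊥-elim (X<R⇒≢ (<-≤-trans (X<Middle F<) Middle≤R) eq)
  ... | inj₂ (inj₂ q^a≡2)       | _       = ⊥-elim (q^a≢2 q^a≡2)
  ... | inj₂ (inj₁ _)           | inj₁ S< = ⊥-elim (X<R⇒≢ (≤-<-trans X≤Middle (Middle<R S<)) eq)
  ... | inj₂ (inj₁ ord≡totient) | inj₂ (rest≡[] , e≡0) =
    pn , n≢p , subst (λ x → Coprime x n) (sym q≡p^k) (prime-power-coprime k pn pp n≢p)
       , subst (λ x → ord q x ≡ totient x) (sym n≡r) ord≡totient
    where
      n≡r : n ≡ r
      n≡r = trans n≡m*p^e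
        (trans (cong (λ x → m * p ^ x) e≡0) (trans (*-identityʳ m) (rest≡[]⇒m≡r rest≡[])))
      pn : Prime n
      pn = subst Prime (sym n≡r) r-prime
      n≢p : n ≢ p
      n≢p n≡p = p∤m (subst (_∣ m) (trans (sym n≡r) n≡p) r∣m)

prime≡m*p^e⇒m≡prime : ∀ {p n m} e → Prime p → Prime n → n ≢ p → n ≡ m * p ^ e → m ≡ n
prime≡m*p^e⇒m≡prime {m = m} zero    _  _  _   n≡m*1 = trans (sym (*-identityʳ m)) (sym n≡m*1)
prime≡m*p^e⇒m≡prime {p} {m = m} (suc e) pp pn n≢p n≡m*p^e
  with prime⇒irreducible pn (subst (p ∣_) (sym n≡m*p^e) (∣-trans (m∣m*n (p ^ e)) (divides m refl)))
... | inj₁ p≡1 = ⊥-elim (¬prime[1] (subst Prime p≡1 pp))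
... | inj₂ p≡n = ⊥-elim (n≢p (sym p≡n))

theorem1p4 : (p q k n m e : ℕ) → Prime p → 1 ≤ k → q ≡ p ^ k → 2 ≤ n →
    n ≡ m * p ^ e → ¬ (p ∣ m) →
    (+ (q * lhs q n m) ℤ.≤ + (q ∸ 1) ℤ.* mobSum q n m)
    × ((+ (q * lhs q n m) ≡ + (q ∸ 1) ℤ.* mobSum q n m)
    ⇔ (m ≡ 1 ⊎ (Prime n × n ≢ p × IsPrimitiveRoot q n)))
theorem1p4 p q k n zero e _ _ _ 2≤n n≡0 _ = ⊥-elim (m<n⇒n≢0 2≤n n≡0)
theorem1p4 p q k n (suc zero) e _ _ _ 2≤n _ _ =
  ℤP.≤-reflexive equality , mk⇔ (λ _ → inj₁ refl) (λ _ → equality)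
  where equality = equality-m≡1 q n (<⇒≤ 2≤n)
theorem1p4 p q k n m@(suc (suc _)) e pp 1≤k q≡p^k _ n≡m*p^e p∤m =
  inequality , mk⇔ (inj₂ ∘ equality⇒prime-primitive) prime-primitive⇒equality
  where
    open Composite {e = e} pp 1≤k q≡p^k n≡m*p^e p∤m (s≤s (s≤s z≤n))
    prime-primitive⇒equality : m ≡ 1 ⊎ (Prime n × n ≢ p × IsPrimitiveRoot q n) →
                               + (q * lhs q n m) ≡ + (q ∸ 1) ℤ.* mobSum q n m
    prime-primitive⇒equality (inj₁ ())
    prime-primitive⇒equality (inj₂ (pn , n≢p , primitive-root)) =
      subst (λ x → + (q * lhs q n x) ≡ + (q ∸ 1) ℤ.* mobSum q n x)
            (sym (prime≡m*p^e⇒m≡prime e pp pn n≢p n≡m*p^e))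
        (equality-prime pn (≤-trans (s≤s z≤n) 2≤q) primitive-root)
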